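{- If a d-sequent $!\Xi;\Gamma,!A,\Delta\Rightarrow C$ is derivable in $!_{\mathrm d}\mathbf{ACT}_\omega^{\mathrm m}$ (where necessarily $A$ is a monoidal implication), then the d-sequent $!\Xi\cup\{!A\};\Gamma,\Delta\Rightarrow C$ is also derivable in $!_{\mathrm d}\mathbf{ACT}_\omega^{\mathrm m}$.
   Context: Formulas are built from a countable set of variables and constants $0,1$ using binary $\backslash$, $/$, $\cdot$, $\oplus$, $\&$, unary postfix ${}^*$ and unary prefix $!$. A monoidal implication is a formula $(b_1\cdot\ldots\cdot b_n)\backslash(c_1\cdot\ldots\cdot c_m)$ with $n,m\ge0$ and $b_i,c_j$ variables (an empty product stands for $1$). Only formulas in which every subformula of the form $!B$ has $B$ a monoidal implication are considered. A d-sequent is $!\Xi;\Gamma\Rightarrow C$ with $C$ a formula, $\Gamma$ a finite (possibly empty) sequence of formulas, and $!\Xi$ a finite set of formulas $!B$ with $B$ a monoidal implication. $A^n$ denotes $n$ copies of $A$. The calculus $!_{\mathrm d}\mathbf{ACT}_\omega^{\mathrm m}$ (same $!\Xi$ in all premises and conclusion unless displayed otherwise): axioms $!\Xi;A\Rightarrow A$; $!\Xi;\ \Rightarrow1$; $!\Xi;\Gamma,0,\Delta\Rightarrow C$; $!\Xi;\ \Rightarrow A^*$. Rules (premises / conclusion): ($\backslash L$) $!\Xi;\Pi\Rightarrow A$, $!\Xi;\Gamma,B,\Delta\Rightarrow C$ / $!\Xi;\Gamma,\Pi,A\backslash B,\Delta\Rightarrow C$; ($\backslash R$) $!\Xi;A,\Pi\Rightarrow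 B$ / $!\Xi;\Pi\Rightarrow A\backslash B$; ($/L$) $!\Xi;\Pi\Rightarrow A$, $!\Xi;\Gamma,B,\Delta\Rightarrow C$ / $!\Xi;\Gamma,B/A,\Pi,\Delta\Rightarrow C$; ($/R$) $!\Xi;\Pi,A\Rightarrow B$ / $!\Xi;\Pi\Rightarrow B/A$; ($\cdot L$) $!\Xi;\Gamma,A,B,\Delta\Rightarrow C$ / $!\Xi;\Gamma,A\cdot B,\Delta\Rightarrow C$; ($\cdot R$) $!\Xi;\Gamma\Rightarrow A$, $!\Xi;\Delta\Rightarrow B$ / $!\Xi;\Gamma,\Delta\Rightarrow A\cdot B$; ($1L$) $!\Xi;\Gamma,\Delta\Rightarrow C$ / $!\Xi;\Gamma,1,\Delta\Rightarrow C$; ($\oplus L$) $!\Xi;\Gamma,A_1,\Delta\Rightarrow C$, $!\Xi;\Gamma,A_2,\Delta\Rightarrow C$ / $!\Xi;\Gamma,A_1\oplus A_2,\Delta\Rightarrow C$; ($\oplus R_i$) $!\Xi;\Pi\Rightarrow A_i$ / $!\Xi;\Pi\Rightarrow A_1\oplus A_2$; ($\&L_i$) $!\Xi;\Gamma,A_i,\Delta\Rightarrow C$ / $!\Xi;\Gamma,A_1\&A_2,\Delta\Rightarrow C$; ($\&R$) $!\Xi;\Pi\Rightarrow A_1$, $!\Xi;\Pi\Rightarrow A_2$ / $!\Xi;\Pi\Rightarrow A_1\&A_2$; (${}^*L_\omega$) $(!\Xi;\Gamma,A^n,\Delta\Rightarrow C)_{n\in\omega}$ / $!\Xi;\Gamma,A^*,\Delta\Rightarrow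 C$; (${}^*R_n$, $n\ge1$) $!\Xi;\Pi_1\Rightarrow A,\dots,!\Xi;\Pi_n\Rightarrow A$ / $!\Xi;\Pi_1,\dots,\Pi_n\Rightarrow A^*$; $(!L)_{\mathrm d}$ $!\Xi\cup\{!A\};\Gamma,\Delta\Rightarrow C$ / $!\Xi;\Gamma,!A,\Delta\Rightarrow C$; $(!R)_{\mathrm d}$ $!\Xi;\ \Rightarrow B$ / $!\Xi;\ \Rightarrow!B$; $(A)_{\mathrm d}$ $!\Xi;\Gamma,c_1,\dots,c_m,\Delta\Rightarrow C$ / $\{!((b_1\cdot\ldots\cdot b_n)\backslash(c_1\cdot\ldots\cdot c_m))\}\cup!\Xi;\Gamma,b_1,\dots,b_n,\Delta\Rightarrow C$; $(\mathrm{Cut})_{\mathrm d1}$ $!\Xi;\Pi\Rightarrow A$, $!\Xi;\Gamma,A,\Delta\Rightarrow C$ / $!\Xi;\Gamma,\Pi,\Delta\Rightarrow C$; $(\mathrm{Cut})_{\mathrm d2}$ $!\Xi;\ \Rightarrow B$, $!\Xi\cup\{!B\};\Gamma\Rightarrow C$ / $!\Xi;\Gamma\Rightarrow C$. Derivable d-sequents form the least set containing the axioms and closed under the rules. -}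

module Defs where

open import Data.Nat using (ℕ; suc)
open import Data.Fin using (Fin)
open import Data.List using (List; []; _∷_; _++_; [_]; replicate; concat; map)
open import Data.List.Membership.Propositional using (_∈_)
import Data.Vec.Functional as VF

Var : Set
Var = ℕ

-- A monoidal implication (b₁·…·bₙ)\(c₁·…·cₘ) is given by the two lists of
-- variables [b₁,…,bₙ] and [c₁,…,cₘ].
record MonImp : Set where
  constructor _⟹_
  field
    lhs : List Var
    rhs : List Var

infixr 30 _·_
infixr 25 _\\_
infixl 25 _//_

-- Formulas.  The exponential ! is only applied to monoidal implications,
-- so every formula of this type satisfies the paper's restriction
-- "every subformula !B has B a monoidal implication".
data Formula : Set where
  var   : Var → Formula
  𝟎 𝟏   : Formula
  _\\_  : Formula → Formula → Formula
  _//_  : Formula → Formula → Formula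
  _·_   : Formula → Formula → Formula
  _⊕_   : Formula → Formula → Formula
  _&_   : Formula → Formula → Formula
  _⋆    : Formula → Formula
  !_    : MonImp → Formula

prod : List Var → Formula
prod []           = 𝟏
prod (b ∷ [])     = var b
prod (b ∷ c ∷ bs) = var b · prod (c ∷ bs)

⌜_⌝ : MonImp → Formula
⌜ bs ⟹ cs ⌝ = prod bs \\ prod cs

Ctx : Set
Ctx = List Formula

-- The set !Ξ is represented by a list Ξ of monoidal implications
-- (!Ξ = { !B | B ∈ Ξ }), considered up to having the same members
-- (rule `set-eq`), i.e. lists represent finite sets.
-- D Ξ Γ C  :  the d-sequent  !Ξ ; Γ ⇒ C  is derivable in !_d ACT_ω^m.
data D : List MonImp → Ctx → Formula → Set where
  set-eq : ∀ {Ξ Ξ' Γ C} → (∀ {m} → m ∈ Ξ → m ∈ Ξ') → (∀ {m} → m ∈ Ξ' → m ∈ Ξ)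
         → D Ξ Γ C → D Ξ' Γ C
  ax    : ∀ {Ξ A} → D Ξ [ A ] A
  1R    : ∀ {Ξ} → D Ξ [] 𝟏
  0L    : ∀ {Ξ Γ Δ C} → D Ξ (Γ ++ 𝟎 ∷ Δ) C
  ⋆ax   : ∀ {Ξ A} → D Ξ [] (A ⋆)
  \\L   : ∀ {Ξ Π Γ Δ A B C} → D Ξ Π A → D Ξ (Γ ++ B ∷ Δ) C
        → D Ξ (Γ ++ Π ++ (A \\ B) ∷ Δ) C
  \\R   : ∀ {Ξ Π A B} → D Ξ (A ∷ Π) B → D Ξ Π (A \\ B)
  //L   : ∀ {Ξ Π Γ Δ A B C} → D Ξ Π A → D Ξ (Γ ++ B ∷ Δ) C
        → D Ξ (Γ ++ (B // A) ∷ Π ++ Δ) C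
  //R   : ∀ {Ξ Π A B} → D Ξ (Π ++ [ A ]) B → D Ξ Π (B // A)
  ·L    : ∀ {Ξ Γ Δ A B C} → D Ξ (Γ ++ A ∷ B ∷ Δ) C → D Ξ (Γ ++ (A · B) ∷ Δ) C
  ·R    : ∀ {Ξ Γ Δ A B} → D Ξ Γ A → D Ξ Δ B → D Ξ (Γ ++ Δ) (A · B)
  1L    : ∀ {Ξ Γ Δ C} → D Ξ (Γ ++ Δ) C → D Ξ (Γ ++ 𝟏 ∷ Δ) C
  ⊕L    : ∀ {Ξ Γ Δ A₁ A₂ C} → D Ξ (Γ ++ A₁ ∷ Δ) C → D Ξ (Γ ++ A₂ ∷ Δ) C
        → D Ξ (Γ ++ (A₁ ⊕ A₂) ∷ Δ) C
  ⊕R₁   : ∀ {Ξ Π A₁ A₂} → D Ξ Π A₁ → D Ξ Π (A₁ ⊕ A₂)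
  ⊕R₂   : ∀ {Ξ Π A₁ A₂} → D Ξ Π A₂ → D Ξ Π (A₁ ⊕ A₂)
  &L₁   : ∀ {Ξ Γ Δ A₁ A₂ C} → D Ξ (Γ ++ A₁ ∷ Δ) C → D Ξ (Γ ++ (A₁ & A₂) ∷ Δ) C
  &L₂   : ∀ {Ξ Γ Δ A₁ A₂ C} → D Ξ (Γ ++ A₂ ∷ Δ) C → D Ξ (Γ ++ (A₁ & A₂) ∷ Δ) C
  &R    : ∀ {Ξ Π A₁ A₂} → D Ξ Π A₁ → D Ξ Π A₂ → D Ξ Π (A₁ & A₂)
  ⋆Lω   : ∀ {Ξ Γ Δ A C} → ((n : ℕ) → D Ξ (Γ ++ replicate n A ++ Δ) C)
        → D Ξ (Γ ++ (A ⋆) ∷ Δ) C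
  -- *R_n with n = suc k ≥ 1 premises Π₁ … Πₙ
  ⋆Rn   : ∀ {Ξ A} (k : ℕ) (Πs : Fin (suc k) → Ctx) → ((i : Fin (suc k)) → D Ξ (Πs i) A)
        → D Ξ (concat (VF.toList Πs)) (A ⋆)
  !Ld   : ∀ {Ξ Γ Δ A C} → D (A ∷ Ξ) (Γ ++ Δ) C → D Ξ (Γ ++ (! A) ∷ Δ) C
  !Rd   : ∀ {Ξ B} → D Ξ [] ⌜ B ⌝ → D Ξ [] (! B)
  Ad    : ∀ {Ξ Γ Δ bs cs C} → D Ξ (Γ ++ map var cs ++ Δ) C
        → D ((bs ⟹ cs) ∷ Ξ) (Γ ++ map var bs ++ Δ) C
  cut₁  : ∀ {Ξ Π Γ Δ A C} → D Ξ Π A → D Ξ (Γ ++ A ∷ Δ) C → D Ξ (Γ ++ Π ++ Δ) C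
  cut₂  : ∀ {Ξ Γ B C} → D Ξ [] ⌜ B ⌝ → D (B ∷ Ξ) Γ C → D Ξ Γ C

{-# OPTIONS --safe #-}
-- Once !A is in the set !Ξ, the sequent !Ξ ; ⇒ !A is derivable: by (A)_d the
-- variables b₁,…,bₙ rewrite to c₁,…,cₘ, which prove c₁·…·cₘ.  Derivability is
-- monotone in the set !Ξ, so weakening the given derivation by !A and cutting
-- it against !A (with (Cut)_d1 and an empty Π) removes !A from the antecedent.
module Submission where

open import Defs
open import Data.List using (List; []; _∷_; _++_; [_]; map)
open import Data.List.Properties using (++-assoc; ++-identityʳ)
open import Data.List.Membership.Propositional using (_∈_)
open import Data.List.Relation.Binary.Subset.Propositional using (_⊆_)
open import Data.List.Relation.Binary.Subset.Propositional.Properties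
  using (∷⁺ʳ; ∈-∷⁺ʳ; xs⊆x∷xs)
open import Data.List.Relation.Unary.Any using (here)
open import Function using (id; _∘_)
open import Relation.Binary.PropositionalEquality using (_≡_; refl; sym; subst)

D-cast : ∀ {Ξ Γ Γ' C} → Γ ≡ Γ' → D Ξ Γ C → D Ξ Γ' C
D-cast = subst (λ Γ → D _ Γ _)

absorb : ∀ {Ξ m Γ C} → m ∈ Ξ → D (m ∷ Ξ) Γ C → D Ξ Γ C
absorb m∈Ξ = set-eq (∈-∷⁺ʳ m∈Ξ id) (xs⊆x∷xs _ _)

weaken : ∀ {Ξ Ξ' Γ C} → Ξ ⊆ Ξ' → D Ξ Γ C → D Ξ' Γ C
weaken f (set-eq g h d) = weaken (f ∘ g) d
weaken f ax = ax
weaken f 1R = 1R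
weaken f 0L = 0L
weaken f ⋆ax = ⋆ax
weaken f (\\L d e) = \\L (weaken f d) (weaken f e)
weaken f (\\R d) = \\R (weaken f d)
weaken f (//L d e) = //L (weaken f d) (weaken f e)
weaken f (//R d) = //R (weaken f d)
weaken f (·L d) = ·L (weaken f d)
weaken f (·R d e) = ·R (weaken f d) (weaken f e)
weaken f (1L d) = 1L (weaken f d)
weaken f (⊕L d e) = ⊕L (weaken f d) (weaken f e)
weaken f (⊕R₁ d) = ⊕R₁ (weaken f d)
weaken f (⊕R₂ d) = ⊕R₂ (weaken f d)
weaken f (&L₁ d) = &L₁ (weaken f d)
weaken f (&L₂ d) = &L₂ (weaken f d)
weaken f (&R d e) = &R (weaken f d) (weaken f e)
weaken f (⋆Lω ds) = ⋆Lω (λ n → weaken f (ds n))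
weaken f (⋆Rn k Πs ds) = ⋆Rn k Πs (λ i → weaken f (ds i))
weaken f (!Ld d) = !Ld (weaken (∷⁺ʳ _ f) d)
weaken f (!Rd d) = !Rd (weaken f d)
weaken f (Ad {Γ = Γ} {Δ = Δ} d) =
  absorb (f (here refl)) (Ad {Γ = Γ} {Δ = Δ} (weaken (f ∘ xs⊆x∷xs _ _) d))
weaken f (cut₁ d e) = cut₁ (weaken f d) (weaken f e)
weaken f (cut₂ d e) = cut₂ (weaken f d) (weaken (∷⁺ʳ _ f) e)

prod-L : ∀ {Ξ C} (Γ Δ : Ctx) (bs : List Var)
       → D Ξ (Γ ++ map var bs ++ Δ) C → D Ξ (Γ ++ prod bs ∷ Δ) C
prod-L Γ Δ [] d = 1L d
prod-L Γ Δ (b ∷ []) d = d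
prod-L Γ Δ (b ∷ c ∷ bs) d =
  ·L (D-cast (++-assoc Γ [ var b ] _)
       (prod-L (Γ ++ [ var b ]) Δ (c ∷ bs)
         (D-cast (sym (++-assoc Γ [ var b ] _)) d)))

prod-R : ∀ {Ξ} (bs : List Var) → D Ξ (map var bs) (prod bs)
prod-R [] = 1R
prod-R (b ∷ []) = ax
prod-R (b ∷ c ∷ bs) = ·R {Γ = [ var b ]} ax (prod-R (c ∷ bs))

!R-∈ : ∀ {Ξ A} → A ∈ Ξ → D Ξ [] (! A)
!R-∈ {A = bs ⟹ cs} A∈Ξ =
  !Rd (\\R (prod-L [] [] bs
    (absorb A∈Ξ (Ad {Γ = []} {Δ = []} (D-cast (sym (++-identityʳ (map var cs))) (prod-R cs))))))

lemma3p3 : (Ξ : List MonImp) (Γ Δ : List Formula) (A : MonImp) (C : Formula)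
    → D Ξ (Γ ++ (! A) ∷ Δ) C → D (A ∷ Ξ) (Γ ++ Δ) C
lemma3p3 Ξ Γ _ A _ d = cut₁ {Π = []} {Γ = Γ} (!R-∈ (here refl)) (weaken (xs⊆x∷xs Ξ A) d)
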